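{- Let $G$ be a graph and $C$ a cycle of $G$ of length at least five. Suppose that a maximum clique $K$ of the subgraph $G[V(C)]$ has size at least four. Then for each pair of vertices of $K$ there is a path between them in $G$ consisting only of chords of $C$.
   Context: A chord of a cycle $C$ in $G$ is an edge of $G$ joining two vertices that are not consecutive on $C$. -}

module Defs where

open import Data.Nat as ℕ using (ℕ; suc; _≤_; s≤s)
open import Data.Nat.Properties using (_<?_)
open import Data.Fin using (Fin; zero; toℕ; fromℕ<)
open import Data.List using (List; []; _∷_; length)
open import Data.List.Membership.Propositional using (_∈_)
open import Data.List.Relation.Unary.All using (All)
open import Data.List.Relation.Unary.Unique.Propositional using (Unique)
open import Data.Product using (Σ; ∃; _×_)
open import Data.Sum using (_⊎_)
open import Relation.Nullary using (¬_; yes; no)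
open import Relation.Binary.PropositionalEquality using (_≡_; _≢_)

record Graph (n : ℕ) : Set₁ where
  field
    Adj    : Fin n → Fin n → Set
    sym    : ∀ {u v} → Adj u v → Adj v u
    irrefl : ∀ {u} → ¬ Adj u u
open Graph public

succMod : ∀ {k} → Fin k → Fin k
succMod {suc m} i with suc (toℕ i) <? suc m
... | yes p = fromℕ< p
... | no _  = zero

record Cycle {n : ℕ} (G : Graph n) (k : ℕ) : Set where
  field
    len≥3 : 3 ≤ k
    vert  : Fin k → Fin n
    inj   : ∀ i j → vert i ≡ vert j → i ≡ j
    edge  : ∀ i → Adj G (vert i) (vert (succMod i))
open Cycle public

module _ {n : ℕ} {G : Graph n} {k : ℕ} (C : Cycle G k) where

  OnC : Fin n → Set
  OnC v = ∃ λ i → vert C i ≡ v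

  Consecutive : Fin n → Fin n → Set
  Consecutive u v = ∃ λ i →
    (vert C i ≡ u × vert C (succMod i) ≡ v) ⊎ (vert C i ≡ v × vert C (succMod i) ≡ u)

  Chord : Fin n → Fin n → Set
  Chord u v = Adj G u v × OnC u × OnC v × ¬ Consecutive u v

  IsCliqueOfC : List (Fin n) → Set
  IsCliqueOfC K = Unique K × All OnC K ×
    (∀ {x y} → x ∈ K → y ∈ K → x ≢ y → Adj G x y)

  IsMaxCliqueOfC : List (Fin n) → Set
  IsMaxCliqueOfC K = IsCliqueOfC K × (∀ L → IsCliqueOfC L → length L ≤ length K)

  data ChordWalk : Fin n → Fin n → List (Fin n) → Set where
    here : ∀ {u} → ChordWalk u u (u ∷ [])
    step : ∀ {u w v P} → Chord u w → ChordWalk w v P → ChordWalk u v (u ∷ P)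

  ChordPath : Fin n → Fin n → List (Fin n) → Set
  ChordPath u v P = ChordWalk u v P × Unique P

{-# OPTIONS --safe #-}
-- Consecutiveness on C is the edge relation of the k-cycle, so every vertex is
-- consecutive to at most two others, and for k ≥ 5 there is no closed walk
-- a u v b a of consecutive pairs with a ≠ v and u ≠ b (it would force the
-- cyclic shift to have order dividing 4). Given u ≠ v in K, either uv is a
-- chord, or it is a cycle edge; then pick two more vertices a, b of K. If one
-- of them is consecutive to neither u nor v it is the middle of a path of two
-- chords. Otherwise, by the degree bound, say ua and bv are cycle edges, and
-- u b a v is a path of three chords: any further consecutive pair would give
-- u or v a third neighbour on C, or close the forbidden square u a b v.
module Submission where

open import Defs
open import Data.Nat using (ℕ; suc; zero; _+_; _*_; _≤_; _<_; NonZero; s≤s; z≤n)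
open import Data.Nat.Properties
  using (_<?_; +-comm; +-suc; +-cancelʳ-≡; ≮⇒≥; ≤-antisym; ≤-trans; ≤⇒≯; ≤-pred)
open import Data.Nat.DivMod
  using (_%_; _/_; m<n⇒m%n≡m; n%n≡0; m%n%n≡m%n; %-distribˡ-+; [m+n]%n≡m%n; m≡m%n+[m/n]*n)
open import Data.Nat.Divisibility using (_∣_; divides; ∣⇒≤)
open import Data.Fin using (Fin; toℕ)
open import Data.Fin.Properties using (toℕ-fromℕ<; toℕ<n; toℕ-injective; any?; _≟_)
open import Data.List using (List; []; _∷_; length)
open import Data.List.Properties using (length-removeAt′)
open import Data.List.Membership.Propositional using (_∈_; _∉_)
open import Data.List.Relation.Unary.Any using (here; there; index; _─_)
open import Data.List.Relation.Unary.All as All using (All; []; _∷_)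
open import Data.List.Relation.Unary.AllPairs using ([]; _∷_)
open import Data.List.Relation.Unary.Unique.Propositional using (Unique)
open import Data.Product using (∃; _×_; _,_; proj₁)
open import Data.Sum using (_⊎_; inj₁; inj₂; [_,_]′)
import Data.Sum as Sum
open import Data.Empty using (⊥; ⊥-elim)
open import Function using (_∘_)
open import Relation.Nullary using (¬_; Dec; yes; no)
open import Relation.Nullary.Decidable using (_×-dec_; _⊎-dec_)
open import Relation.Binary.Definitions using (DecidableEquality)
open import Relation.Binary.PropositionalEquality
  using (_≡_; _≢_; refl; trans; cong; ≢-sym; module ≡-Reasoning)
import Relation.Binary.PropositionalEquality as ≡

module _ {k : ℕ} where
  open import Function.Endo.Propositional (Fin k) using (_^_) public

toℕ-succMod : ∀ {m} (i : Fin (suc m)) → toℕ (succMod i) ≡ suc (toℕ i) % suc m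
toℕ-succMod {m} i with suc (toℕ i) <? suc m
... | yes i+1<k = trans (toℕ-fromℕ< i+1<k) (≡.sym (m<n⇒m%n≡m i+1<k))
... | no i+1≮k = trans (≡.sym (n%n≡0 (suc m)))
                      (cong (_% suc m) (≤-antisym (≮⇒≥ i+1≮k) (toℕ<n i)))

[m+n%d]%d≡[m+n]%d : ∀ m n d .{{_ : NonZero d}} → (m + n % d) % d ≡ (m + n) % d
[m+n%d]%d≡[m+n]%d m n d = begin
  (m + n % d) % d           ≡⟨ %-distribˡ-+ m (n % d) d ⟩
  (m % d + n % d % d) % d   ≡⟨ cong (λ r → (m % d + r) % d) (m%n%n≡m%n n d) ⟩
  (m % d + n % d) % d       ≡⟨ %-distribˡ-+ m n d ⟨
  (m + n) % d               ∎
  where open ≡-Reasoning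

toℕ-succMod^ : ∀ {m} j (i : Fin (suc m)) → toℕ ((succMod ^ j) i) ≡ (j + toℕ i) % suc m
toℕ-succMod^ {m} zero i = ≡.sym (m<n⇒m%n≡m (toℕ<n i))
toℕ-succMod^ {m} (suc j) i = begin
  toℕ (succMod ((succMod ^ j) i))      ≡⟨ toℕ-succMod ((succMod ^ j) i) ⟩
  suc (toℕ ((succMod ^ j) i)) % suc m  ≡⟨ cong (λ r → suc r % suc m) (toℕ-succMod^ j i) ⟩
  (1 + (j + toℕ i) % suc m) % suc m    ≡⟨ [m+n%d]%d≡[m+n]%d 1 (j + toℕ i) (suc m) ⟩
  suc (j + toℕ i) % suc m              ∎
  where open ≡-Reasoning

m+toℕ-succMod : ∀ {m} (i : Fin (suc m)) → (m + toℕ (succMod i)) % suc m ≡ toℕ i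
m+toℕ-succMod {m} i = begin
  (m + toℕ (succMod i)) % suc m        ≡⟨ cong (λ r → (m + r) % suc m) (toℕ-succMod i) ⟩
  (m + suc (toℕ i) % suc m) % suc m    ≡⟨ [m+n%d]%d≡[m+n]%d m (suc (toℕ i)) (suc m) ⟩
  (m + suc (toℕ i)) % suc m            ≡⟨ cong (_% suc m) (+-suc m (toℕ i)) ⟩
  (suc m + toℕ i) % suc m              ≡⟨ cong (_% suc m) (+-comm (suc m) (toℕ i)) ⟩
  (toℕ i + suc m) % suc m              ≡⟨ [m+n]%n≡m%n (toℕ i) (suc m) ⟩
  toℕ i % suc m                        ≡⟨ m<n⇒m%n≡m (toℕ<n i) ⟩
  toℕ i                                ∎
  where open ≡-Reasoning

succMod-injective : ∀ {k} {i j : Fin k} → succMod i ≡ succMod j → i ≡ j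
succMod-injective {suc m} {i} {j} eq = toℕ-injective (begin
  toℕ i                           ≡⟨ m+toℕ-succMod i ⟨
  (m + toℕ (succMod i)) % suc m   ≡⟨ cong (λ r → (m + toℕ r) % suc m) eq ⟩
  (m + toℕ (succMod j)) % suc m   ≡⟨ m+toℕ-succMod j ⟩
  toℕ j                           ∎)
  where open ≡-Reasoning

succMod^-fixed⇒∣ : ∀ {m} j {i : Fin (suc m)} → (succMod ^ j) i ≡ i → suc m ∣ j
succMod^-fixed⇒∣ {m} j {i} fixed = divides q (+-cancelʳ-≡ (toℕ i) j (q * suc m) (begin
  j + toℕ i                         ≡⟨ m≡m%n+[m/n]*n (j + toℕ i) (suc m) ⟩
  (j + toℕ i) % suc m + q * suc m   ≡⟨ cong (_+ q * suc m) (toℕ-succMod^ j i) ⟨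
  toℕ ((succMod ^ j) i) + q * suc m ≡⟨ cong (λ r → toℕ r + q * suc m) fixed ⟩
  toℕ i + q * suc m                 ≡⟨ +-comm (toℕ i) (q * suc m) ⟩
  q * suc m + toℕ i                 ∎))
  where
  open ≡-Reasoning
  q = (j + toℕ i) / suc m

succMod⁴-≢ : ∀ {k} → 5 ≤ k → (i : Fin k) → (succMod ^ 4) i ≢ i
succMod⁴-≢ {suc m} 5≤k i fixed = ≤⇒≯ (∣⇒≤ (succMod^-fixed⇒∣ 4 fixed)) 5≤k

module _ {A : Set} (_≟ᴬ_ : DecidableEquality A) where
  open import Data.List.Membership.DecPropositional _≟ᴬ_ using (_∈?_)

  ∈-─ : ∀ {x y : A} {xs} (x∈xs : x ∈ xs) → y ∈ xs → y ≡ x ⊎ y ∈ (xs ─ x∈xs)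
  ∈-─ (here refl) (here y≡x)  = inj₁ y≡x
  ∈-─ (here _)    (there y∈xs) = inj₂ y∈xs
  ∈-─ (there _)   (here y≡x)  = inj₂ (here y≡x)
  ∈-─ (there x∈xs) (there y∈xs) = Sum.map₂ there (∈-─ x∈xs y∈xs)

  unique-longer⇒∃∉ : ∀ F {L : List A} → Unique L → length F < length L →
                     ∃ λ a → a ∈ L × a ∉ F
  unique-longer⇒∃∉ F {x ∷ L} (x∉L ∷ unique-L) |F|<|x∷L| with x ∈? F
  ... | no x∉F = x , here refl , x∉F
  ... | yes x∈F with unique-longer⇒∃∉ (F ─ x∈F) unique-L |F─x|<|L|
    where
    |F─x|<|L| : length (F ─ x∈F) < length L
    |F─x|<|L| = ≤-pred (≡.subst (_< length (x ∷ L)) (length-removeAt′ F (index x∈F)) |F|<|x∷L|)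
  ...   | a , a∈L , a∉F─x =
    a , there a∈L , [ (λ { refl → All.lookup x∉L a∈L refl }) , a∉F─x ]′ ∘ ∈-─ x∈F

module _ {n : ℕ} {G : Graph n} {k : ℕ} (C : Cycle G k) where

  Next : Fin n → Fin n → Set
  Next x y = ∃ λ i → vert C i ≡ x × vert C (succMod i) ≡ y

  consecutive⇒next : ∀ {x y} → Consecutive C x y → Next x y ⊎ Next y x
  consecutive⇒next (i , inj₁ x→y) = inj₁ (i , x→y)
  consecutive⇒next (i , inj₂ y→x) = inj₂ (i , y→x)

  consecutive-sym : ∀ {x y} → Consecutive C x y → Consecutive C y x
  consecutive-sym (i , x→y) = i , Sum.swap x→y

  consecutive? : ∀ x y → Dec (Consecutive C x y)
  consecutive? x y = any? λ i →
    ((vert C i ≟ x) ×-dec (vert C (succMod i) ≟ y)) ⊎-dec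
    ((vert C i ≟ y) ×-dec (vert C (succMod i) ≟ x))

  next-functional : ∀ {x y y′} → Next x y → Next x y′ → y ≡ y′
  next-functional (i , refl , refl) (j , vᵢ≡vⱼ , refl) with inj C i j (≡.sym vᵢ≡vⱼ)
  ... | refl = refl

  next-injective : ∀ {x x′ y} → Next x y → Next x′ y → x ≡ x′
  next-injective (i , refl , refl) (j , refl , vᵢ₊₁≡vⱼ₊₁)
    with succMod-injective (inj C _ _ (≡.sym vᵢ₊₁≡vⱼ₊₁))
  ... | refl = refl

  ¬consecutive-to-three : ∀ {x a b c} →
    Consecutive C x a → Consecutive C x b → Consecutive C x c → a ≢ b → a ≢ c → b ≢ c → ⊥
  ¬consecutive-to-three xa xb xc a≢b a≢c b≢c
    with consecutive⇒next xa | consecutive⇒next xb | consecutive⇒next xc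
  ... | inj₁ x→a | inj₁ x→b | _        = a≢b (next-functional x→a x→b)
  ... | inj₂ a→x | inj₂ b→x | _        = a≢b (next-injective a→x b→x)
  ... | inj₁ x→a | inj₂ _   | inj₁ x→c = a≢c (next-functional x→a x→c)
  ... | inj₁ _   | inj₂ b→x | inj₂ c→x = b≢c (next-injective b→x c→x)
  ... | inj₂ _   | inj₁ x→b | inj₁ x→c = b≢c (next-functional x→b x→c)
  ... | inj₂ a→x | inj₁ _   | inj₂ c→x = a≢c (next-injective a→x c→x)

  ¬next-cycle₄ : 5 ≤ k → ∀ {p q r s} → Next p q → Next q r → Next r s → Next s p → ⊥
  ¬next-cycle₄ 5≤k (i , refl , refl) (j , vᵢ₊₁≡vⱼ , refl) (l , vⱼ₊₁≡vₗ , refl)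
                   (m , vₗ₊₁≡vₘ , vₘ₊₁≡vᵢ)
    with inj C _ _ vᵢ₊₁≡vⱼ | inj C _ _ vⱼ₊₁≡vₗ | inj C _ _ vₗ₊₁≡vₘ
  ... | refl | refl | refl = succMod⁴-≢ 5≤k i (inj C _ _ vₘ₊₁≡vᵢ)

  ¬consecutive-square : 5 ≤ k → ∀ {a u v b} →
    Consecutive C a u → Consecutive C u v → Consecutive C v b → Consecutive C b a →
    a ≢ v → u ≢ b → ⊥
  ¬consecutive-square 5≤k au uv vb ba a≢v u≢b
    with consecutive⇒next au | consecutive⇒next uv | consecutive⇒next vb | consecutive⇒next ba
  ... | inj₁ a→u | inj₂ v→u | _        | _        = a≢v (next-injective a→u v→u)
  ... | inj₂ u→a | inj₁ u→v | _        | _        = a≢v (next-functional u→a u→v)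
  ... | _        | inj₁ u→v | inj₂ b→v | _        = u≢b (next-injective u→v b→v)
  ... | _        | inj₂ v→u | inj₁ v→b | _        = u≢b (next-functional v→u v→b)
  ... | _        | _        | inj₁ v→b | inj₂ a→b = a≢v (next-injective a→b v→b)
  ... | _        | _        | inj₂ b→v | inj₁ b→a = a≢v (next-functional b→a b→v)
  ... | inj₁ a→u | inj₁ u→v | inj₁ v→b | inj₁ b→a = ¬next-cycle₄ 5≤k a→u u→v v→b b→a
  ... | inj₂ u→a | inj₂ v→u | inj₂ b→v | inj₂ a→b = ¬next-cycle₄ 5≤k a→b b→v v→u u→a

  chordPath₁ : ∀ {u v} → u ≢ v → Chord C u v → ChordPath C u v (u ∷ v ∷ [])
  chordPath₁ u≢v uv = step uv here , (u≢v ∷ []) ∷ [] ∷ []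

  chordPath₂ : ∀ {u w v} → u ≢ w → u ≢ v → w ≢ v →
               Chord C u w → Chord C w v → ChordPath C u v (u ∷ w ∷ v ∷ [])
  chordPath₂ u≢w u≢v w≢v uw wv =
    step uw (step wv here) , (u≢w ∷ u≢v ∷ []) ∷ (w≢v ∷ []) ∷ [] ∷ []

  chordPath₃ : ∀ {u x y v} → u ≢ x → u ≢ y → u ≢ v → x ≢ y → x ≢ v → y ≢ v →
               Chord C u x → Chord C x y → Chord C y v →
               ChordPath C u v (u ∷ x ∷ y ∷ v ∷ [])
  chordPath₃ u≢x u≢y u≢v x≢y x≢v y≢v ux xy yv =
    step ux (step xy (step yv here)) ,
    (u≢x ∷ u≢y ∷ u≢v ∷ []) ∷ (x≢y ∷ x≢v ∷ []) ∷ (y≢v ∷ []) ∷ [] ∷ []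

  module _ (5≤k : 5 ≤ k) {K : List (Fin n)} (K-clique : IsCliqueOfC C K) where

    chord-in-clique : ∀ {x y} → x ∈ K → y ∈ K → x ≢ y → ¬ Consecutive C x y → Chord C x y
    chord-in-clique x∈K y∈K x≢y x≁y = let (_ , on-C , adjacent) = K-clique in
      adjacent x∈K y∈K x≢y , All.lookup on-C x∈K , All.lookup on-C y∈K , x≁y

    chordPath-zigzag : ∀ {u v a b} → u ∈ K → v ∈ K → a ∈ K → b ∈ K →
      u ≢ v → u ≢ a → u ≢ b → v ≢ a → v ≢ b → a ≢ b →
      Consecutive C u v → Consecutive C u a → Consecutive C b v → ∃ (ChordPath C u v)
    chordPath-zigzag {u} {v} {a} {b} u∈K v∈K a∈K b∈K u≢v u≢a u≢b v≢a v≢b a≢b uv ua bv =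
      _ , chordPath₃ u≢b u≢a u≢v (≢-sym a≢b) (≢-sym v≢b) (≢-sym v≢a)
            (chord-in-clique u∈K b∈K u≢b u≁b)
            (chord-in-clique b∈K a∈K (≢-sym a≢b) b≁a)
            (chord-in-clique a∈K v∈K (≢-sym v≢a) a≁v)
      where
      vu = consecutive-sym uv
      u≁b : ¬ Consecutive C u b
      u≁b ub = ¬consecutive-to-three uv ua ub v≢a v≢b a≢b
      b≁a : ¬ Consecutive C b a
      b≁a ba = ¬consecutive-square 5≤k ua (consecutive-sym ba) bv vu u≢b (≢-sym v≢a)
      a≁v : ¬ Consecutive C a v
      a≁v av = ¬consecutive-to-three vu (consecutive-sym bv) (consecutive-sym av) u≢b u≢a (≢-sym a≢b)

    chordPath-from-four-in-clique : ∀ {u v a b} → u ∈ K → v ∈ K → a ∈ K → b ∈ K →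
      u ≢ v → u ≢ a → u ≢ b → v ≢ a → v ≢ b → a ≢ b → ∃ (ChordPath C u v)
    chordPath-from-four-in-clique {u} {v} {a} {b} u∈K v∈K a∈K b∈K u≢v u≢a u≢b v≢a v≢b a≢b
      with consecutive? u v
    ... | no u≁v = _ , chordPath₁ u≢v (chord-in-clique u∈K v∈K u≢v u≁v)
    ... | yes uv with consecutive? u a | consecutive? a v | consecutive? u b | consecutive? b v
    ...   | no u≁a | no a≁v | _      | _      = _ , chordPath₂ u≢a u≢v (≢-sym v≢a)
      (chord-in-clique u∈K a∈K u≢a u≁a) (chord-in-clique a∈K v∈K (≢-sym v≢a) a≁v)
    ...   | _      | _      | no u≁b | no b≁v = _ , chordPath₂ u≢b u≢v (≢-sym v≢b)
      (chord-in-clique u∈K b∈K u≢b u≁b) (chord-in-clique b∈K v∈K (≢-sym v≢b) b≁v)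
    ...   | yes ua | _      | yes ub | _      =
      ⊥-elim (¬consecutive-to-three uv ua ub v≢a v≢b a≢b)
    ...   | _      | yes av | _      | yes bv =
      ⊥-elim (¬consecutive-to-three (consecutive-sym uv) (consecutive-sym av) (consecutive-sym bv)
                                    u≢a u≢b a≢b)
    ...   | yes ua | _      | _      | yes bv =
      chordPath-zigzag u∈K v∈K a∈K b∈K u≢v u≢a u≢b v≢a v≢b a≢b uv ua bv
    ...   | _      | yes av | yes ub | _      =
      chordPath-zigzag u∈K v∈K b∈K a∈K u≢v u≢b u≢a v≢b v≢a (≢-sym a≢b) uv ub av

lemma2p6 : (n : ℕ) (G : Graph n) (k : ℕ) (C : Cycle G k) → 5 ≤ k →
    (K : List (Fin n)) → IsMaxCliqueOfC C K → 4 ≤ length K →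
    ∀ {u v} → u ∈ K → v ∈ K → u ≢ v → ∃ λ P → ChordPath C u v P
lemma2p6 n G k C 5≤k K (K-clique , _) 4≤|K| {u} {v} u∈K v∈K u≢v
  with unique-longer⇒∃∉ _≟_ (u ∷ v ∷ []) (proj₁ K-clique) (≤-trans (s≤s (s≤s (s≤s z≤n))) 4≤|K|)
... | a , a∈K , a∉uv with unique-longer⇒∃∉ _≟_ (u ∷ v ∷ a ∷ []) (proj₁ K-clique) 4≤|K|
... | b , b∈K , b∉uva =
  chordPath-from-four-in-clique C 5≤k K-clique u∈K v∈K a∈K b∈K u≢v
    (a∉uv ∘ here ∘ ≡.sym) (b∉uva ∘ here ∘ ≡.sym)
    (a∉uv ∘ there ∘ here ∘ ≡.sym) (b∉uva ∘ there ∘ here ∘ ≡.sym)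
    (b∉uva ∘ there ∘ there ∘ here ∘ ≡.sym)
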